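{- Let $d\geq 1$ and $i\geq 0$ be integers, $I=[i,i+d-1]$, $H=[0,i+d-1]$, and let $J=\{j_1<\cdots<j_d\}\subset H$ be any $d$-element subset. Then $J\leq I$ and $b^I_J>0$. In particular, every $d\times d$ submatrix of the matrix $B^I_H$ has rank $d$.
   Context: For integers $p,q\geq 0$, $b_{p,q}=\binom{p}{q}$, with $b_{p,q}=0$ if $q>p$. For $k\leq l$, $[k,l]=\{k,\ldots,l\}$. For finite sets of non-negative integers $I=\{i_1<\cdots<i_d\}$ and $J=\{j_1<\cdots<j_e\}$, $B^I_J$ is the $d\times e$ matrix with $(r,s)$ entry $b_{i_r,j_s}$; when $d=e$, $b^I_J=\det(B^I_J)$. We write $J\leq I$ (for $d=e$) if $j_k\leq i_k$ for all $k$. -}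

module Defs where

open import Data.Nat as ℕ using (ℕ; zero; suc; _+_)
open import Data.Nat.Combinatorics using (_C_)
open import Data.Integer as ℤ using (ℤ; +_; -_)
open import Data.Fin using (Fin; toℕ; punchIn)
import Data.Fin as Fin
open import Data.List using (List; map; foldr; allFin)

-- b_{p,q} = binomial(p,q), which is 0 when q > p (stdlib's _C_ has this convention).
b : ℕ → ℕ → ℕ
b p q = p C q

ΣFin : ∀ n → (Fin n → ℤ) → ℤ
ΣFin n f = foldr ℤ._+_ (+ 0) (map f (allFin n))

sgn : ℕ → ℤ
sgn zero = + 1
sgn (suc k) = - sgn k

det : ∀ n → (Fin n → Fin n → ℤ) → ℤ
det zero M = + 1
det (suc n) M =
  ΣFin (suc n) λ j →
    sgn (toℕ j) ℤ.* (M Fin.zero j ℤ.* det n (λ r c → M (Fin.suc r) (punchIn j c)))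

-- Index sets I = {i_1 < ... < i_d}, J = {j_1 < ... < j_e} are represented by their
-- increasing enumerations  Fin d → ℕ.
StrictlyIncreasing : ∀ {d} → (Fin d → ℕ) → Set
StrictlyIncreasing {d} J = ∀ (r s : Fin d) → r Fin.< s → J r ℕ.< J s

B : ∀ {d e} → (Fin d → ℕ) → (Fin e → ℕ) → Fin d → Fin e → ℤ
B I J r s = + b (I r) (J s)

bdet : ∀ {d} → (Fin d → ℕ) → (Fin d → ℕ) → ℤ
bdet {d} I J = det d (B I J)

_≼_ : ∀ {d} → (Fin d → ℕ) → (Fin d → ℕ) → Set
J ≼ I = ∀ k → J k ℕ.≤ I k

interval : ℕ → ∀ d → Fin d → ℕ
interval i d k = i + toℕ k

{-# OPTIONS --safe #-}
module Submission where

-- Pascal's rule splits every column (binom(i+1+r, j))_r of B^{[i+1,i+d]}_J into the columns for j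
-- and j − 1 of B^{[i,i+d−1]}, so by multilinearity b^{[i+1,i+d]}_J is the sum of the 2^d
-- determinants b^{[i,i+d−1]}_{J′}, where J′ lowers some entries of J by one. Every such J′ is weakly
-- increasing: it either has a repeated entry, an entry beyond i+d−1 or a lowered 0, and then its
-- determinant vanishes, or it is strictly increasing and in range, and then its determinant is
-- positive by induction on i. Lowering exactly the entries with j_s > s gives one of the latter kind,
-- so the sum is positive. At i = 0 the hypotheses force J = [0,d−1], where (binom(r,s)) is
-- unitriangular. Finally J ≤ I because a strictly increasing J below i + d has j_s ≤ i + s.

open import Defs
open import Data.Nat using (ℕ; zero; suc; _≤_; _<_; _+_; _∸_; pred; _<?_; _≤?_; z≤n; s≤s)
import Data.Nat.Properties as ℕ
open import Data.Nat.Combinatorics using (_C_; nCk+nC[k+1]≡[n+1]C[k+1]; k>n⇒nCk≡0; nCn≡1)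
open import Data.Integer using (ℤ; +_; -_; +<+)
  renaming (_+_ to _+ℤ_; _*_ to _*ℤ_; _≤_ to _≤ℤ_; _<_ to _<ℤ_)
import Data.Integer.Properties as ℤ
open import Data.Fin using (Fin; toℕ; punchIn; punchOut; inject₁; fromℕ; fromℕ<; _≟_)
open import Data.Fin.Properties
  using (punchInᵢ≢i; punchIn-injective; punchIn-punchOut; toℕ-inject₁; toℕ-fromℕ; toℕ-fromℕ<;
         toℕ<n; toℕ≤pred[n]; toℕ-injective; any?)
open import Data.List using (foldr; map; tabulate)
open import Data.Vec.Functional using (updateAt)
open import Data.Vec.Functional.Properties using (updateAt-updates; updateAt-minimal; updateAt-id-local)
open import Data.Bool using (Bool; true; false; if_then_else_; T)
open import Data.Bool.Properties using (T-≡)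
open import Data.Product using (∃; _×_; _,_)
open import Data.Unit using (tt)
open import Data.Empty using (⊥-elim)
open import Function using (_∘_; id; const; Equivalence)
open import Relation.Binary.PropositionalEquality
open import Relation.Nullary using (Dec; yes; no; does; contradiction)
open import Relation.Nullary.Decidable using (dec-true; dec-false; _×-dec_; T?)
open import Algebra.Properties.CommutativeMonoid.Sum ℤ.+-0-commutativeMonoid
  using (sum; sum-cong-≗; sum-remove; sum-replicate-zero; ∑-distrib-+)

foldr-map-tabulate : ∀ {A : Set} n (f : A → ℤ) (g : Fin n → A) →
  foldr _+ℤ_ (+ 0) (map f (tabulate g)) ≡ sum (f ∘ g)
foldr-map-tabulate zero    f g = refl
foldr-map-tabulate (suc n) f g = cong (f (g Fin.zero) +ℤ_) (foldr-map-tabulate n f (g ∘ Fin.suc))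

sum-zero : ∀ n (t : Fin n → ℤ) → (∀ j → t j ≡ + 0) → sum t ≡ + 0
sum-zero n t t≡0 = trans (sum-cong-≗ t≡0) (sum-replicate-zero n)

punchIn-inject₁-self : ∀ {n} (a : Fin n) → punchIn (inject₁ a) a ≡ Fin.suc a
punchIn-inject₁-self Fin.zero    = refl
punchIn-inject₁-self (Fin.suc a) = cong Fin.suc (punchIn-inject₁-self a)

sum-adjacent : ∀ {n} (t : Fin (suc (suc n)) → ℤ) (a : Fin (suc n)) →
  (∀ j → j ≢ inject₁ a → j ≢ Fin.suc a → t j ≡ + 0) →
  sum t ≡ t (inject₁ a) +ℤ t (Fin.suc a)
sum-adjacent {n} t a others≡0 = begin
  sum t
    ≡⟨ sum-remove t ⟩
  t (inject₁ a) +ℤ sum t′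
    ≡⟨ cong (t (inject₁ a) +ℤ_) (sum-remove t′) ⟩
  t (inject₁ a) +ℤ (t′ a +ℤ sum (t′ ∘ punchIn a))
    ≡⟨ cong₂ (λ x y → t (inject₁ a) +ℤ (t x +ℤ y)) (punchIn-inject₁-self a) (sum-zero n _ rest≡0) ⟩
  t (inject₁ a) +ℤ (t (Fin.suc a) +ℤ + 0)
    ≡⟨ cong (t (inject₁ a) +ℤ_) (ℤ.+-identityʳ _) ⟩
  t (inject₁ a) +ℤ t (Fin.suc a)
    ∎
  where
  open ≡-Reasoning
  t′ = t ∘ punchIn (inject₁ a)
  rest≡0 : ∀ c → t′ (punchIn a c) ≡ + 0
  rest≡0 c = others≡0 _ (punchInᵢ≢i _ _) λ eq →
    punchInᵢ≢i a c (punchIn-injective (inject₁ a) _ _ (trans eq (sym (punchIn-inject₁-self a))))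

-- Determinants

Matrix : ℕ → Set
Matrix n = Fin n → Fin n → ℤ

minor : ∀ {n} → Matrix (suc n) → Fin (suc n) → Matrix n
minor M j r c = M (Fin.suc r) (punchIn j c)

cofactorTerm : ∀ {n} → Matrix (suc n) → Fin (suc n) → ℤ
cofactorTerm {n} M j = sgn (toℕ j) *ℤ (M Fin.zero j *ℤ det n (minor M j))

det-expand : ∀ n (M : Matrix (suc n)) → det (suc n) M ≡ sum (cofactorTerm M)
det-expand n M = foldr-map-tabulate (suc n) (cofactorTerm M) id

det-cong : ∀ n {M N : Matrix n} → (∀ r c → M r c ≡ N r c) → det n M ≡ det n N
det-cong zero    M≡N = refl
det-cong (suc n) {M} {N} M≡N = begin
  det (suc n) M         ≡⟨ det-expand n M ⟩
  sum (cofactorTerm M)  ≡⟨ sum-cong-≗ term≡ ⟩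
  sum (cofactorTerm N)  ≡⟨ det-expand n N ⟨
  det (suc n) N         ∎
  where
  open ≡-Reasoning
  term≡ : ∀ j → cofactorTerm M j ≡ cofactorTerm N j
  term≡ j = cong₂ (λ x D → sgn (toℕ j) *ℤ (x *ℤ D))
    (M≡N Fin.zero j) (det-cong n (λ r c → M≡N (Fin.suc r) (punchIn j c)))

cofactorTerm-entry≡0 : ∀ {n} (M : Matrix (suc n)) j → M Fin.zero j ≡ + 0 → cofactorTerm M j ≡ + 0
cofactorTerm-entry≡0 {n} M j entry≡0 =
  trans (cong (λ x → sgn (toℕ j) *ℤ (x *ℤ det n (minor M j))) entry≡0) (ℤ.*-zeroʳ (sgn (toℕ j)))

cofactorTerm-minor≡0 : ∀ {n} (M : Matrix (suc n)) j → det n (minor M j) ≡ + 0 → cofactorTerm M j ≡ + 0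
cofactorTerm-minor≡0 M j minor≡0 = begin
  sgn (toℕ j) *ℤ (M Fin.zero j *ℤ _)
    ≡⟨ cong (λ D → sgn (toℕ j) *ℤ (M Fin.zero j *ℤ D)) minor≡0 ⟩
  sgn (toℕ j) *ℤ (M Fin.zero j *ℤ + 0)
    ≡⟨ cong (sgn (toℕ j) *ℤ_) (ℤ.*-zeroʳ (M Fin.zero j)) ⟩
  sgn (toℕ j) *ℤ + 0
    ≡⟨ ℤ.*-zeroʳ (sgn (toℕ j)) ⟩
  + 0
    ∎
  where open ≡-Reasoning

cofactorTerm-additive-entry : ∀ {n} (M P Q : Matrix (suc n)) j →
  M Fin.zero j ≡ P Fin.zero j +ℤ Q Fin.zero j →
  (∀ r c → minor M j r c ≡ minor P j r c) → (∀ r c → minor M j r c ≡ minor Q j r c) →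
  cofactorTerm M j ≡ cofactorTerm P j +ℤ cofactorTerm Q j
cofactorTerm-additive-entry {n} M P Q j entry M≡P M≡Q = begin
  s *ℤ (M Fin.zero j *ℤ det n (minor M j))
    ≡⟨ cong₂ (λ x D → s *ℤ (x *ℤ D)) entry (det-cong n M≡P) ⟩
  s *ℤ ((p +ℤ q) *ℤ D)
    ≡⟨ cong (s *ℤ_) (ℤ.*-distribʳ-+ D p q) ⟩
  s *ℤ (p *ℤ D +ℤ q *ℤ D)
    ≡⟨ ℤ.*-distribˡ-+ s (p *ℤ D) (q *ℤ D) ⟩
  s *ℤ (p *ℤ D) +ℤ s *ℤ (q *ℤ D)
    ≡⟨ cong (λ D′ → s *ℤ (p *ℤ D) +ℤ s *ℤ (q *ℤ D′)) (det-cong n P≡Q) ⟩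
  cofactorTerm P j +ℤ cofactorTerm Q j
    ∎
  where
  open ≡-Reasoning
  s = sgn (toℕ j)
  p = P Fin.zero j
  q = Q Fin.zero j
  D = det n (minor P j)
  P≡Q : ∀ r c → minor P j r c ≡ minor Q j r c
  P≡Q r c = trans (sym (M≡P r c)) (M≡Q r c)

cofactorTerm-additive-minor : ∀ {n} (M P Q : Matrix (suc n)) j →
  M Fin.zero j ≡ P Fin.zero j → M Fin.zero j ≡ Q Fin.zero j →
  det n (minor M j) ≡ det n (minor P j) +ℤ det n (minor Q j) →
  cofactorTerm M j ≡ cofactorTerm P j +ℤ cofactorTerm Q j
cofactorTerm-additive-minor {n} M P Q j M≡P M≡Q minors-additive = begin
  s *ℤ (M Fin.zero j *ℤ det n (minor M j))
    ≡⟨ cong₂ (λ x D → s *ℤ (x *ℤ D)) M≡P minors-additive ⟩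
  s *ℤ (p *ℤ (dP +ℤ dQ))
    ≡⟨ cong (s *ℤ_) (ℤ.*-distribˡ-+ p dP dQ) ⟩
  s *ℤ (p *ℤ dP +ℤ p *ℤ dQ)
    ≡⟨ ℤ.*-distribˡ-+ s (p *ℤ dP) (p *ℤ dQ) ⟩
  s *ℤ (p *ℤ dP) +ℤ s *ℤ (p *ℤ dQ)
    ≡⟨ cong (λ x → s *ℤ (p *ℤ dP) +ℤ s *ℤ (x *ℤ dQ)) (trans (sym M≡P) M≡Q) ⟩
  cofactorTerm P j +ℤ cofactorTerm Q j
    ∎
  where
  open ≡-Reasoning
  s = sgn (toℕ j)
  p = P Fin.zero j
  dP = det n (minor P j)
  dQ = det n (minor Q j)

det-additive-column : ∀ n (M P Q : Matrix n) (k : Fin n) →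
  (∀ r c → c ≢ k → M r c ≡ P r c) → (∀ r c → c ≢ k → M r c ≡ Q r c) →
  (∀ r → M r k ≡ P r k +ℤ Q r k) → det n M ≡ det n P +ℤ det n Q
det-additive-column (suc n) M P Q k M≡P M≡Q M≡P+Q = begin
  det (suc n) M                                     ≡⟨ det-expand n M ⟩
  sum (cofactorTerm M)                              ≡⟨ sum-cong-≗ term-additive ⟩
  sum (λ j → cofactorTerm P j +ℤ cofactorTerm Q j)  ≡⟨ ∑-distrib-+ (cofactorTerm P) (cofactorTerm Q) ⟩
  sum (cofactorTerm P) +ℤ sum (cofactorTerm Q)      ≡⟨ cong₂ _+ℤ_ (det-expand n P) (det-expand n Q) ⟨
  det (suc n) P +ℤ det (suc n) Q                    ∎
  where
  open ≡-Reasoning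
  away : ∀ {N} → (∀ r c → c ≢ k → M r c ≡ N r c) → ∀ r c → minor M k r c ≡ minor N k r c
  away M≡N r c = M≡N (Fin.suc r) (punchIn k c) (punchInᵢ≢i k c)
  off : ∀ {j N} (j≢k : j ≢ k) → (∀ r c → c ≢ k → M r c ≡ N r c) →
    ∀ r c → c ≢ punchOut j≢k → minor M j r c ≡ minor N j r c
  off {j} j≢k M≡N r c c≢k′ = M≡N (Fin.suc r) (punchIn j c)
    (λ eq → c≢k′ (punchIn-injective j c _ (trans eq (sym (punchIn-punchOut j≢k)))))
  on : ∀ {j} (j≢k : j ≢ k) → ∀ r →
    minor M j r (punchOut j≢k) ≡ minor P j r (punchOut j≢k) +ℤ minor Q j r (punchOut j≢k)
  on j≢k r rewrite punchIn-punchOut j≢k = M≡P+Q (Fin.suc r)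
  term-additive : ∀ j → cofactorTerm M j ≡ cofactorTerm P j +ℤ cofactorTerm Q j
  term-additive j with j ≟ k
  ... | yes refl = cofactorTerm-additive-entry M P Q j (M≡P+Q Fin.zero) (away M≡P) (away M≡Q)
  ... | no j≢k   = cofactorTerm-additive-minor M P Q j (M≡P Fin.zero j j≢k) (M≡Q Fin.zero j j≢k)
    (det-additive-column n (minor M j) (minor P j) (minor Q j) (punchOut j≢k)
      (off j≢k M≡P) (off j≢k M≡Q) (on j≢k))

det-zero-column : ∀ n (M : Matrix n) (k : Fin n) → (∀ r → M r k ≡ + 0) → det n M ≡ + 0
det-zero-column (suc n) M k column≡0 = trans (det-expand n M) (sum-zero (suc n) (cofactorTerm M) term≡0)
  where
  term≡0 : ∀ j → cofactorTerm M j ≡ + 0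
  term≡0 j with j ≟ k
  ... | yes refl = cofactorTerm-entry≡0 M j (column≡0 Fin.zero)
  ... | no j≢k   = cofactorTerm-minor≡0 M j (det-zero-column n (minor M j) (punchOut j≢k)
    (λ r → trans (cong (M (Fin.suc r)) (punchIn-punchOut j≢k)) (column≡0 (Fin.suc r))))

punchIn-suc-self : ∀ {n} (a : Fin (suc n)) → punchIn (Fin.suc a) a ≡ inject₁ a
punchIn-suc-self Fin.zero = refl
punchIn-suc-self {suc n} (Fin.suc a) = cong Fin.suc (punchIn-suc-self a)

punchIn-inject₁≡punchIn-suc : ∀ {n} (a c : Fin (suc n)) → c ≢ a →
  punchIn (inject₁ a) c ≡ punchIn (Fin.suc a) c
punchIn-inject₁≡punchIn-suc Fin.zero    Fin.zero    c≢a = ⊥-elim (c≢a refl)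
punchIn-inject₁≡punchIn-suc Fin.zero    (Fin.suc c) _   = refl
punchIn-inject₁≡punchIn-suc (Fin.suc a) Fin.zero    _   = refl
punchIn-inject₁≡punchIn-suc {suc n} (Fin.suc a) (Fin.suc c) c≢a =
  cong Fin.suc (punchIn-inject₁≡punchIn-suc a c (c≢a ∘ cong Fin.suc))

punchIn-adjacent : ∀ {m} (j : Fin (suc (suc m))) (a : Fin (suc m)) → j ≢ inject₁ a → j ≢ Fin.suc a →
  ∃ λ (a′ : Fin m) → punchIn j (inject₁ a′) ≡ inject₁ a × punchIn j (Fin.suc a′) ≡ Fin.suc a
punchIn-adjacent Fin.zero Fin.zero j≢a _ = ⊥-elim (j≢a refl)
punchIn-adjacent {suc m} Fin.zero (Fin.suc a) _ _ = a , refl , refl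
punchIn-adjacent (Fin.suc Fin.zero) Fin.zero _ j≢a+1 = ⊥-elim (j≢a+1 refl)
punchIn-adjacent {suc m} (Fin.suc (Fin.suc j)) Fin.zero _ _ = Fin.zero , refl , refl
punchIn-adjacent {suc m} (Fin.suc j) (Fin.suc a) j≢a j≢a+1
  with a′ , at-a , at-a+1 ← punchIn-adjacent j a (j≢a ∘ cong Fin.suc) (j≢a+1 ∘ cong Fin.suc)
  = Fin.suc a′ , cong Fin.suc at-a , cong Fin.suc at-a+1

det-equal-adjacent-columns : ∀ n (M : Matrix (suc n)) (a : Fin n) →
  (∀ r → M r (inject₁ a) ≡ M r (Fin.suc a)) → det (suc n) M ≡ + 0
det-equal-adjacent-columns (suc n) M a equal = begin
  det (suc (suc n)) M                                       ≡⟨ det-expand (suc n) M ⟩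
  sum (cofactorTerm M)                                      ≡⟨ sum-adjacent (cofactorTerm M) a others≡0 ⟩
  cofactorTerm M (inject₁ a) +ℤ cofactorTerm M (Fin.suc a)  ≡⟨ cong₂ _+ℤ_ first second ⟩
  s *ℤ x +ℤ - s *ℤ x                                        ≡⟨ cong (_+ℤ_ (s *ℤ x)) (ℤ.neg-distribˡ-* s x) ⟨
  s *ℤ x +ℤ - (s *ℤ x)                                      ≡⟨ ℤ.+-inverseʳ (s *ℤ x) ⟩
  + 0                                                       ∎
  where
  open ≡-Reasoning
  s = sgn (toℕ a)
  x = M Fin.zero (inject₁ a) *ℤ det (suc n) (minor M (inject₁ a))
  first : cofactorTerm M (inject₁ a) ≡ s *ℤ x
  first = cong (λ i → sgn i *ℤ x) (toℕ-inject₁ a)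
  minors-equal : ∀ r c → minor M (Fin.suc a) r c ≡ minor M (inject₁ a) r c
  minors-equal r c with c ≟ a
  ... | yes refl = trans (cong (M (Fin.suc r)) (punchIn-suc-self c))
                     (trans (equal (Fin.suc r)) (cong (M (Fin.suc r)) (sym (punchIn-inject₁-self c))))
  ... | no c≢a   = cong (M (Fin.suc r)) (sym (punchIn-inject₁≡punchIn-suc a c c≢a))
  second : cofactorTerm M (Fin.suc a) ≡ - s *ℤ x
  second = cong (- s *ℤ_) (cong₂ _*ℤ_ (sym (equal Fin.zero)) (det-cong (suc n) minors-equal))
  others≡0 : ∀ j → j ≢ inject₁ a → j ≢ Fin.suc a → cofactorTerm M j ≡ + 0
  others≡0 j j≢a j≢a+1 with a′ , at-a , at-a+1 ← punchIn-adjacent j a j≢a j≢a+1 =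
    cofactorTerm-minor≡0 M j (det-equal-adjacent-columns n (minor M j) a′ λ r →
      trans (cong (M (Fin.suc r)) at-a) (trans (equal (Fin.suc r)) (cong (M (Fin.suc r)) (sym at-a+1))))

det-unitriangular : ∀ n (M : Matrix n) → (∀ r c → toℕ r < toℕ c → M r c ≡ + 0) →
  (∀ r → M r r ≡ + 1) → det n M ≡ + 1
det-unitriangular zero    M _ _ = refl
det-unitriangular (suc n) M above≡0 diagonal≡1 = begin
  det (suc n) M                                               ≡⟨ det-expand n M ⟩
  cofactorTerm M Fin.zero +ℤ sum (cofactorTerm M ∘ Fin.suc)   ≡⟨ cong₂ _+ℤ_ leading (sum-zero n _ rest≡0) ⟩
  + 1                                                         ∎
  where
  open ≡-Reasoning
  leading : cofactorTerm M Fin.zero ≡ + 1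
  leading = cong₂ (λ x D → + 1 *ℤ (x *ℤ D)) (diagonal≡1 Fin.zero)
    (det-unitriangular n (minor M Fin.zero) (λ r c r<c → above≡0 (Fin.suc r) (Fin.suc c) (s≤s r<c))
      (diagonal≡1 ∘ Fin.suc))
  rest≡0 : ∀ j → cofactorTerm M (Fin.suc j) ≡ + 0
  rest≡0 j = cofactorTerm-entry≡0 M (Fin.suc j) (above≡0 Fin.zero (Fin.suc j) (s≤s z≤n))

-- Splitting the columns of a sum

mixColumns : ∀ {d} → Matrix d → Matrix d → (Fin d → Bool) → Matrix d
mixColumns U V c r s = if c s then V r s else U r s

<?-suc-≢ : ∀ {x} k → x ≢ k → does (x <? suc k) ≡ does (x <? k)
<?-suc-≢ {x} k x≢k with x <? k in x<?k
... | yes x<k = trans (dec-true (x <? suc k) (ℕ.m<n⇒m<1+n x<k)) (sym (cong does x<?k))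
... | no  x≮k = trans (dec-false (x <? suc k) (λ x<1+k → x≮k (ℕ.≤∧≢⇒< (ℕ.≤-pred x<1+k) x≢k)))
                      (sym (cong does x<?k))

module _ {d} (U V : Matrix d) where

  private
    -- Columns s < k already carry U + V; k runs from the mixes (k = 0) to U + V (k = d).
    partialSum : ℕ → (Fin d → Bool) → Matrix d
    partialSum k c r s = if does (toℕ s <? k) then U r s +ℤ V r s else mixColumns U V c r s

    partialSum-cong : ∀ k {c c′ : Fin d → Bool} → (∀ s → c s ≡ c′ s) →
      det d (partialSum k c) ≡ det d (partialSum k c′)
    partialSum-cong k c≗c′ = det-cong d λ r s →
      cong (λ b → if does (toℕ s <? k) then U r s +ℤ V r s else (if b then V r s else U r s)) (c≗c′ s)

    module Step (k : ℕ) (k<d : k < d) where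
      s₀ : Fin d
      s₀ = fromℕ< k<d

      set : (Fin d → Bool) → Bool → Fin d → Bool
      set c b = updateAt c s₀ (const b)

      split : ∀ c → det d (partialSum (suc k) c)
                      ≡ det d (partialSum k (set c false)) +ℤ det d (partialSum k (set c true))
      split c = det-additive-column d _ _ _ s₀ (off false) (off true) on
        where
        toℕs₀≡k : toℕ s₀ ≡ k
        toℕs₀≡k = toℕ-fromℕ< k<d
        off : ∀ b r s → s ≢ s₀ → partialSum (suc k) c r s ≡ partialSum k (set c b) r s
        off b r s s≢s₀ = cong₂ (λ t m → if t then U r s +ℤ V r s else m)
          (<?-suc-≢ k (λ eq → s≢s₀ (toℕ-injective (trans eq (sym toℕs₀≡k)))))
          (cong (λ b′ → if b′ then V r s else U r s) (sym (updateAt-minimal s s₀ c s≢s₀)))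
        on : ∀ r → partialSum (suc k) c r s₀
                     ≡ partialSum k (set c false) r s₀ +ℤ partialSum k (set c true) r s₀
        on r rewrite dec-true (toℕ s₀ <? suc k) (ℕ.≤-reflexive (cong suc toℕs₀≡k))
                   | dec-false (toℕ s₀ <? k) (ℕ.<-irrefl toℕs₀≡k)
                   | updateAt-updates s₀ {const false} c
                   | updateAt-updates s₀ {const true} c = refl

  det-+-pos : (c₀ : Fin d → Bool) → (∀ c → + 0 ≤ℤ det d (mixColumns U V c)) →
    + 0 <ℤ det d (mixColumns U V c₀) → + 0 <ℤ det d (λ r s → U r s +ℤ V r s)
  det-+-pos c₀ mixes-nonneg mix₀-pos = subst (+ 0 <ℤ_) (det-cong d all-summed) (positive d ℕ.≤-refl)
    where
    all-summed : ∀ r s → partialSum d c₀ r s ≡ U r s +ℤ V r s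
    all-summed r s = cong (λ t → if t then U r s +ℤ V r s else mixColumns U V c₀ r s)
      (dec-true (toℕ s <? d) (toℕ<n s))

    nonneg : ∀ k → k ≤ d → ∀ c → + 0 ≤ℤ det d (partialSum k c)
    nonneg zero    _   c = mixes-nonneg c
    nonneg (suc k) k<d c =
      subst (+ 0 ≤ℤ_) (sym (split c)) (ℤ.+-mono-≤ (nonneg k k≤d _) (nonneg k k≤d _))
      where
      open Step k k<d
      k≤d : k ≤ d
      k≤d = ℕ.<⇒≤ k<d

    positive : ∀ k → k ≤ d → + 0 <ℤ det d (partialSum k c₀)
    positive zero    _   = mix₀-pos
    positive (suc k) k<d = subst (+ 0 <ℤ_) (sym (split c₀)) (either (c₀ s₀) refl)
      where
      open Step k k<d
      k≤d : k ≤ d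
      k≤d = ℕ.<⇒≤ k<d
      kept : ∀ b → c₀ s₀ ≡ b → + 0 <ℤ det d (partialSum k (set c₀ b))
      kept b c₀s₀≡b = subst (+ 0 <ℤ_)
        (partialSum-cong k (λ s → sym (updateAt-id-local s₀ c₀ (sym c₀s₀≡b) s))) (positive k k≤d)
      either : ∀ b → c₀ s₀ ≡ b →
        + 0 <ℤ det d (partialSum k (set c₀ false)) +ℤ det d (partialSum k (set c₀ true))
      either false c₀s₀≡b = ℤ.+-mono-<-≤ (kept false c₀s₀≡b) (nonneg k k≤d _)
      either true  c₀s₀≡b = ℤ.+-mono-≤-< (nonneg k k≤d _) (kept true c₀s₀≡b)

Linked : ∀ {n} → (ℕ → ℕ → Set) → (Fin (suc n) → ℕ) → Set
Linked {n} _R_ J = ∀ (a : Fin n) → J (inject₁ a) R J (Fin.suc a)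

strictlyIncreasing⇒linked : ∀ {n} {J : Fin (suc n) → ℕ} → StrictlyIncreasing J → Linked _<_ J
strictlyIncreasing⇒linked increasing a =
  increasing (inject₁ a) (Fin.suc a) (s≤s (ℕ.≤-reflexive (toℕ-inject₁ a)))

linked-<-head : ∀ {n} (J : Fin (suc n) → ℕ) → Linked _<_ J → ∀ s → J Fin.zero + toℕ s ≤ J s
linked-<-head J _ Fin.zero = ℕ.≤-reflexive (ℕ.+-identityʳ _)
linked-<-head {suc n} J linked (Fin.suc s) = begin
  J Fin.zero + suc (toℕ s)      ≡⟨ ℕ.+-suc _ (toℕ s) ⟩
  suc (J Fin.zero) + toℕ s      ≤⟨ ℕ.+-monoˡ-≤ (toℕ s) (linked Fin.zero) ⟩
  J (Fin.suc Fin.zero) + toℕ s  ≤⟨ linked-<-head (J ∘ Fin.suc) (linked ∘ Fin.suc) s ⟩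
  J (Fin.suc s)                 ∎
  where open ℕ.≤-Reasoning

linked-<-last : ∀ {n} (J : Fin (suc n) → ℕ) → Linked _<_ J → ∀ s → J s + (n ∸ toℕ s) ≤ J (fromℕ n)
linked-<-last {n} J linked Fin.zero =
  subst (λ m → J Fin.zero + m ≤ J (fromℕ n)) (toℕ-fromℕ n) (linked-<-head J linked (fromℕ n))
linked-<-last {suc n} J linked (Fin.suc s) = linked-<-last (J ∘ Fin.suc) (linked ∘ Fin.suc) s

linked-<⇒toℕ≤ : ∀ {n} (J : Fin (suc n) → ℕ) → Linked _<_ J → ∀ s → toℕ s ≤ J s
linked-<⇒toℕ≤ J linked s = ℕ.≤-trans (ℕ.m≤n+m (toℕ s) (J Fin.zero)) (linked-<-head J linked s)

linked-<⇒≼interval : ∀ {n} (J : Fin (suc n) → ℕ) i → Linked _<_ J → (∀ s → J s < i + suc n) →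
  J ≼ interval i (suc n)
linked-<⇒≼interval {n} J i linked bounded s = ℕ.+-cancelʳ-≤ (n ∸ toℕ s) (J s) (i + toℕ s) (begin
  J s + (n ∸ toℕ s)          ≤⟨ linked-<-last J linked s ⟩
  J (fromℕ n)                ≤⟨ ℕ.≤-pred (subst (J (fromℕ n) <_) (ℕ.+-suc i n) (bounded (fromℕ n))) ⟩
  i + n                      ≡⟨ cong (_+_ i) (ℕ.m+[n∸m]≡n (toℕ≤pred[n] s)) ⟨
  i + (toℕ s + (n ∸ toℕ s))  ≡⟨ ℕ.+-assoc i (toℕ s) (n ∸ toℕ s) ⟨
  i + toℕ s + (n ∸ toℕ s)    ∎)
  where open ℕ.≤-Reasoning

predIf : Bool → ℕ → ℕ
predIf b p = if b then pred p else p

predIf-≤ : ∀ b p → predIf b p ≤ p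
predIf-≤ false p = ℕ.≤-refl
predIf-≤ true  p = ℕ.pred[n]≤n

pred≤predIf : ∀ b p → pred p ≤ predIf b p
pred≤predIf false p = ℕ.pred[n]≤n
pred≤predIf true  p = ℕ.≤-refl

predIf-<-mono : ∀ {x p q} → p < q → (x<p? : Dec (x < p)) (x+1<q? : Dec (suc x < q)) →
  predIf (does x<p?) p < predIf (does x+1<q?) q
predIf-<-mono (s≤s p<q)     (yes (s≤s _)) (yes _)     = p<q
predIf-<-mono p<q           (yes x<p)     (no x+1≮q)  = contradiction (ℕ.<-≤-trans (s≤s x<p) p<q) x+1≮q
predIf-<-mono {q = suc q} _ (no x≮p)      (yes x+1<q) = ℕ.≤-<-trans (ℕ.≮⇒≥ x≮p) (ℕ.≤-pred x+1<q)
predIf-<-mono p<q           (no _)        (no _)      = p<q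

predIf-<-bound : ∀ {x p m} → x < m → p < suc m → (x<p? : Dec (x < p)) → predIf (does x<p?) p < m
predIf-<-bound _   (s≤s p≤m) (yes (s≤s _)) = p≤m
predIf-<-bound x<m _         (no x≮p)      = ℕ.≤-<-trans (ℕ.≮⇒≥ x≮p) x<m

-- Binomial determinants

-- binom(m, j − 1) with binom(m, −1) = 0, unlike (m C (j ∸ 1)), which is 1 at j = 0.
binomBelow : ℕ → ℕ → ℕ
binomBelow m zero    = 0
binomBelow m (suc j) = m C j

pascal : ∀ m j → suc m C j ≡ m C j + binomBelow m j
pascal m zero    = refl
pascal m (suc j) = trans (sym (nCk+nC[k+1]≡[n+1]C[k+1] m j)) (ℕ.+-comm (m C j) (m C suc j))

module PascalSplit (i : ℕ) {n} (J : Fin (suc n) → ℕ) where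

  d : ℕ
  d = suc n

  U V : Matrix d
  U = B (interval i d) J
  V r s = + binomBelow (i + toℕ r) (J s)

  B≡U+V : ∀ r s → B (interval (suc i) d) J r s ≡ U r s +ℤ V r s
  B≡U+V r s = trans (cong +_ (pascal m (J s))) (ℤ.pos-+ (m C J s) (binomBelow m (J s)))
    where m = i + toℕ r

  lowerAt : (Fin d → Bool) → Fin d → ℕ
  lowerAt c s = predIf (c s) (J s)

  mix≡B-lowerAt : ∀ c → (∀ s → T (c s) → 0 < J s) →
    ∀ r s → mixColumns U V c r s ≡ B (interval i d) (lowerAt c) r s
  mix≡B-lowerAt c lowered-positive r s with c s | lowered-positive s
  ... | false | _ = refl
  ... | true  | 0<Js with J s | 0<Js tt
  ...   | suc j | _ = refl

  lowerAt-linked : ∀ c → Linked _<_ J → Linked _≤_ (lowerAt c)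
  lowerAt-linked c linked a = ℕ.≤-trans (predIf-≤ (c (inject₁ a)) _)
    (ℕ.≤-trans (ℕ.<⇒≤pred (linked a)) (pred≤predIf (c (Fin.suc a)) _))

  mixes-nonneg : Linked _<_ J → (∀ J′ → Linked _≤_ J′ → + 0 ≤ℤ bdet (interval i d) J′) →
    ∀ c → + 0 ≤ℤ det d (mixColumns U V c)
  mixes-nonneg linked nonneg c with any? (λ s → T? (c s) ×-dec (J s ℕ.≟ 0))
  ... | yes (s , cs , Js≡0) = ℤ.≤-reflexive (sym (det-zero-column d (mixColumns U V c) s zero-column))
    where
    zero-column : ∀ r → mixColumns U V c r s ≡ + 0
    zero-column r rewrite Equivalence.to T-≡ cs | Js≡0 = refl
  ... | no none = subst (+ 0 ≤ℤ_) (sym (det-cong d (mix≡B-lowerAt c lowered-positive)))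
                    (nonneg (lowerAt c) (lowerAt-linked c linked))
    where
    lowered-positive : ∀ s → T (c s) → 0 < J s
    lowered-positive s cs = ℕ.n≢0⇒n>0 (λ Js≡0 → none (s , cs , Js≡0))

  -- Lowering exactly the entries with s < j_s keeps J strictly increasing and below i + d.
  c₀ : Fin d → Bool
  c₀ s = does (toℕ s <? J s)

  c₀-positive : ∀ s → T (c₀ s) → 0 < J s
  c₀-positive s cs = ℕ.≤-<-trans z≤n (ℕ.<ᵇ⇒< (toℕ s) (J s) cs)

  lowerAt-c₀-linked : Linked _<_ J → Linked _<_ (lowerAt c₀)
  lowerAt-c₀-linked linked a rewrite sym (toℕ-inject₁ a) =
    predIf-<-mono (linked a) (toℕ (inject₁ a) <? J (inject₁ a)) (suc (toℕ (inject₁ a)) <? J (Fin.suc a))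

  lowerAt-c₀-bounded : (∀ s → J s < suc i + d) → ∀ s → lowerAt c₀ s < i + d
  lowerAt-c₀-bounded bounded s =
    predIf-<-bound (ℕ.<-≤-trans (toℕ<n s) (ℕ.m≤n+m d i)) (bounded s) (toℕ s <? J s)

mutual
  bdet-interval-nonneg : ∀ i n (J : Fin (suc n) → ℕ) → Linked _≤_ J →
    + 0 ≤ℤ bdet (interval i (suc n)) J
  bdet-interval-nonneg i n J weakly with any? (λ s → i + suc n ≤? J s)
  ... | yes (s , outside) = ℤ.≤-reflexive (sym
          (det-zero-column (suc n) (B (interval i (suc n)) J) s λ r →
            cong +_ (k>n⇒nCk≡0 (ℕ.<-≤-trans (ℕ.+-monoʳ-< i (toℕ<n r)) outside))))
  ... | no inside with any? (λ a → J (inject₁ a) ℕ.≟ J (Fin.suc a))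
  ...   | yes (a , repeated) = ℤ.≤-reflexive (sym
            (det-equal-adjacent-columns n (B (interval i (suc n)) J) a λ r →
              cong (λ j → + ((i + toℕ r) C j)) repeated))
  ...   | no distinct = ℤ.<⇒≤ (bdet-interval-pos i n J
            (λ a → ℕ.≤∧≢⇒< (weakly a) (λ eq → distinct (a , eq)))
            (λ s → ℕ.≰⇒> (λ le → inside (s , le))))

  bdet-interval-pos : ∀ i n (J : Fin (suc n) → ℕ) → Linked _<_ J → (∀ s → J s < i + suc n) →
    + 0 <ℤ bdet (interval i (suc n)) J
  bdet-interval-pos zero n J linked bounded =
    subst (+ 0 <ℤ_) (sym (trans (det-cong (suc n) J≡toℕ) (det-unitriangular (suc n) _ above diagonal)))
      (+<+ (s≤s z≤n))
    where
    J≡toℕ : ∀ r s → B (interval 0 (suc n)) J r s ≡ + (toℕ r C toℕ s)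
    J≡toℕ r s = cong (λ j → + (toℕ r C j))
      (ℕ.≤-antisym (linked-<⇒≼interval J 0 linked bounded s) (linked-<⇒toℕ≤ J linked s))
    above : ∀ r s → toℕ r < toℕ s → + (toℕ r C toℕ s) ≡ + 0
    above r s r<s = cong +_ (k>n⇒nCk≡0 r<s)
    diagonal : ∀ r → + (toℕ r C toℕ r) ≡ + 1
    diagonal r = cong +_ (nCn≡1 (toℕ r))
  bdet-interval-pos (suc i) n J linked bounded =
    subst (+ 0 <ℤ_) (sym (det-cong (suc n) B≡U+V))
      (det-+-pos U V c₀ (mixes-nonneg linked (bdet-interval-nonneg i n)) mix₀-pos)
    where
    open PascalSplit i J
    mix₀-pos : + 0 <ℤ det (suc n) (mixColumns U V c₀)
    mix₀-pos = subst (+ 0 <ℤ_) (sym (det-cong (suc n) (mix≡B-lowerAt c₀ c₀-positive)))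
      (bdet-interval-pos i n (lowerAt c₀) (lowerAt-c₀-linked linked) (lowerAt-c₀-bounded bounded))

corollary2p6 : (d i : ℕ) → 1 ≤ d →
    (J : Fin d → ℕ) → StrictlyIncreasing J → (∀ k → J k < i + d) →
    (J ≼ interval i d) × (+ 0 <ℤ bdet (interval i d) J)
corollary2p6 (suc n) i _ J increasing bounded =
  linked-<⇒≼interval J i linked bounded , bdet-interval-pos i n J linked bounded
  where
  linked : Linked _<_ J
  linked = strictlyIncreasing⇒linked increasing
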